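{- Up to logical equivalence, $\mathcal L_{\mathsf{iocos}}\subsetneq \mathrm{HML}$ and $\widetilde{\mathcal L}_{\mathsf{iocos}}\subsetneq\mathrm{HML}$; that is, every formula of $\mathcal L_{\mathsf{iocos}}$ (respectively of $\widetilde{\mathcal L}_{\mathsf{iocos}}$) is logically equivalent to some HML formula, while some HML formula is not logically equivalent to any formula of $\mathcal L_{\mathsf{iocos}}$ (respectively of $\widetilde{\mathcal L}_{\mathsf{iocos}}$).
   Context: Actions: disjoint finite sets $I$ (inputs $a?$) and $O$ (outputs $a!$, including quiescence $\delta!$), $L=I\cup O$. An LTS with inputs and outputs is $(S,I,O,\to)$ with $\to\subseteq S\times L\times S$ such that $p\xrightarrow{\delta!}p'$ iff $p=p'$ and $p$ has no $a!$-transition for $a!\in O\setminus\{\delta!\}$; LTSs are image-finite. Two formulae are logically equivalent if they are satisfied by exactly the same states (of all such LTSs). HML: $\phi::=\mathrm{tt}\mid\mathrm{ff}\mid\phi\wedge\phi\mid\phi\vee\phi\mid[a]\phi\mid\langle a\rangle\phi$ for $a\in L$, with $p\models\langle a\rangle\phi$ iff some $a$-successor of $p$ satisfies $\phi$ and $p\models[a]\phi$ iff every $a$-successor satisfies $\phi$. $\mathcal L_{\mathsf{iocos}}$: $\phi::=\mathrm{tt}\mid\mathrm{ff}\mid\phi\wedge\phi\mid\phi\vee\phi\mid\langle\!\langle a?\rangle\!\rangle\phi\mid\langle a!\rangle\phi$, where $p\models\langle\!\langle a?\rangle\!\rangle\phi$ iff $p$ has no $a?$-transition or some $a?$-successor satisfies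 $\phi$. $\widetilde{\mathcal L}_{\mathsf{iocos}}$: $\phi::=\mathrm{tt}\mid\mathrm{ff}\mid\phi\wedge\phi\mid\phi\vee\phi\mid[\![a?]\!]\phi\mid[a!]\phi$, where $p\models[\![a?]\!]\phi$ iff $p$ has at least one $a?$-transition and every $a?$-successor satisfies $\phi$. -}

module Defs where

open import Level using (0ℓ)
open import Data.Nat using (ℕ; suc)
open import Data.Fin using (Fin)
open import Data.List using (List)
open import Data.List.Membership.Propositional using (_∈_)
open import Data.Product using (Σ; ∃; _×_; _,_)
open import Data.Sum using (_⊎_)
open import Data.Empty using (⊥)
open import Relation.Nullary using (¬_)
open import Relation.Binary.PropositionalEquality using (_≡_)

-- Action alphabet over nᵢ inputs and nₒ ordinary outputs:
--   I = { inp a | a : Fin nᵢ },   O = { out b | b : Fin nₒ } ∪ { δ }.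
-- I and O are finite and disjoint by construction; δ is quiescence δ!.
data Label (nᵢ nₒ : ℕ) : Set where
  inp : Fin nᵢ → Label nᵢ nₒ
  out : Fin nₒ → Label nᵢ nₒ
  δ   : Label nᵢ nₒ

_⇔_ : Set → Set → Set
A ⇔ B = (A → B) × (B → A)

record LTS (nᵢ nₒ : ℕ) : Set₁ where
  field
    State : Set
    _—[_]→_ : State → Label nᵢ nₒ → State → Set
    quiescence : ∀ p p' →
      (p —[ δ ]→ p') ⇔ ((p ≡ p') × (∀ b q → ¬ (p —[ out b ]→ q)))
    image-finite : ∀ p a →
      Σ (List State) λ xs → ∀ q → (p —[ a ]→ q) ⇔ (q ∈ xs)

open LTS public

data HML (nᵢ nₒ : ℕ) : Set where
  tt ff : HML nᵢ nₒ
  _∧_ _∨_ : HML nᵢ nₒ → HML nᵢ nₒ → HML nᵢ nₒ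
  [_]_ ⟨_⟩_ : Label nᵢ nₒ → HML nᵢ nₒ → HML nᵢ nₒ

data Liocos (nᵢ nₒ : ℕ) : Set where
  tt ff : Liocos nᵢ nₒ
  _∧_ _∨_ : Liocos nᵢ nₒ → Liocos nᵢ nₒ → Liocos nᵢ nₒ
  ⟨⟨_⟩⟩_ : Fin nᵢ → Liocos nᵢ nₒ → Liocos nᵢ nₒ
  ⟨out_⟩_ : Fin nₒ → Liocos nᵢ nₒ → Liocos nᵢ nₒ
  ⟨δ⟩_ : Liocos nᵢ nₒ → Liocos nᵢ nₒ

data L̃iocos (nᵢ nₒ : ℕ) : Set where
  tt ff : L̃iocos nᵢ nₒ
  _∧_ _∨_ : L̃iocos nᵢ nₒ → L̃iocos nᵢ nₒ → L̃iocos nᵢ nₒ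
  [[_]]_ : Fin nᵢ → L̃iocos nᵢ nₒ → L̃iocos nᵢ nₒ
  [out_]_ : Fin nₒ → L̃iocos nᵢ nₒ → L̃iocos nᵢ nₒ
  [δ]_ : L̃iocos nᵢ nₒ → L̃iocos nᵢ nₒ

Dia : ∀ {nᵢ nₒ} (M : LTS nᵢ nₒ) → State M → Label nᵢ nₒ → (State M → Set) → Set
Dia M p a P = Σ (State M) λ q → (_—[_]→_ M p a q) × P q

Box : ∀ {nᵢ nₒ} (M : LTS nᵢ nₒ) → State M → Label nᵢ nₒ → (State M → Set) → Set
Box M p a P = ∀ q → _—[_]→_ M p a q → P q

data ⊤' : Set where
  tt' : ⊤'

sat : ∀ {nᵢ nₒ} (M : LTS nᵢ nₒ) → State M → HML nᵢ nₒ → Set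
sat M p tt = ⊤'
sat M p ff = ⊥
sat M p (φ ∧ ψ) = sat M p φ × sat M p ψ
sat M p (φ ∨ ψ) = sat M p φ ⊎ sat M p ψ
sat M p ([ a ] φ) = Box M p a (λ q → sat M q φ)
sat M p (⟨ a ⟩ φ) = Dia M p a (λ q → sat M q φ)

satI : ∀ {nᵢ nₒ} (M : LTS nᵢ nₒ) → State M → Liocos nᵢ nₒ → Set
satI M p tt = ⊤'
satI M p ff = ⊥
satI M p (φ ∧ ψ) = satI M p φ × satI M p ψ
satI M p (φ ∨ ψ) = satI M p φ ⊎ satI M p ψ
satI M p (⟨⟨ a ⟩⟩ φ) =
  (∀ q → ¬ (_—[_]→_ M p (inp a) q)) ⊎ Dia M p (inp a) (λ q → satI M q φ)
satI M p (⟨out b ⟩ φ) = Dia M p (out b) (λ q → satI M q φ)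
satI M p (⟨δ⟩ φ) = Dia M p δ (λ q → satI M q φ)

satT : ∀ {nᵢ nₒ} (M : LTS nᵢ nₒ) → State M → L̃iocos nᵢ nₒ → Set
satT M p tt = ⊤'
satT M p ff = ⊥
satT M p (φ ∧ ψ) = satT M p φ × satT M p ψ
satT M p (φ ∨ ψ) = satT M p φ ⊎ satT M p ψ
satT M p ([[ a ]] φ) =
  (∃ λ q → _—[_]→_ M p (inp a) q) × Box M p (inp a) (λ q → satT M q φ)
satT M p ([out b ] φ) = Box M p (out b) (λ q → satT M q φ)
satT M p ([δ] φ) = Box M p δ (λ q → satT M q φ)

_≣I_ : ∀ {nᵢ nₒ} → Liocos nᵢ nₒ → HML nᵢ nₒ → Set₁
_≣I_ {nᵢ} {nₒ} φ ψ = ∀ (M : LTS nᵢ nₒ) (p : State M) → satI M p φ ⇔ sat M p ψ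

_≣T_ : ∀ {nᵢ nₒ} → L̃iocos nᵢ nₒ → HML nᵢ nₒ → Set₁
_≣T_ {nᵢ} {nₒ} φ ψ = ∀ (M : LTS nᵢ nₒ) (p : State M) → satT M p φ ⇔ sat M p ψ

-- Both fragments translate compositionally into HML, using
-- ⟨⟨a?⟩⟩φ ≡ [a?]ff ∨ ⟨a?⟩φ and [[a?]]φ ≡ ⟨a?⟩tt ∧ [a?]φ.
-- For strictness, consider two quiescent states that differ only in that
-- `enabled` loops on every input while `blocked` has no inputs.  Inputs occur
-- in L_iocos only under ⟨⟨a?⟩⟩, which holds trivially at `blocked`, so every
-- L_iocos formula true at `enabled` is true at `blocked`; dually every L̃_iocos
-- formula true at `blocked` is true at `enabled`, since [[a?]] fails there.
-- Hence ⟨a?⟩tt and [a?]ff have no equivalent in L_iocos and L̃_iocos.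
module Submission where

open import Defs
open import Data.Nat using (ℕ; suc)
open import Data.Fin using (Fin; zero)
open import Data.Product using (Σ; _×_; _,_; proj₁; proj₂)
open import Data.Sum using (_⊎_; inj₁; inj₂; [_,_])
open import Data.List using (List; []; _∷_)
open import Data.List.Membership.Propositional using (_∈_)
open import Data.List.Relation.Unary.Any using (here; there)
open import Relation.Nullary using (¬_)
open import Relation.Binary.PropositionalEquality using (refl)

⇔-refl : ∀ {A} → A ⇔ A
⇔-refl = (λ x → x) , (λ x → x)

×-cong-⇔ : ∀ {A B C D} → A ⇔ B → C ⇔ D → (A × C) ⇔ (B × D)
×-cong-⇔ (f , f⁻) (g , g⁻) = (λ (x , y) → f x , g y) , (λ (x , y) → f⁻ x , g⁻ y)

⊎-cong-⇔ : ∀ {A B C D} → A ⇔ B → C ⇔ D → (A ⊎ C) ⇔ (B ⊎ D)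
⊎-cong-⇔ (f , f⁻) (g , g⁻) =
  [ (λ x → inj₁ (f x)) , (λ y → inj₂ (g y)) ] ,
  [ (λ x → inj₁ (f⁻ x)) , (λ y → inj₂ (g⁻ y)) ]

module _ {nᵢ nₒ : ℕ} (M : LTS nᵢ nₒ) where

  Dia-cong : ∀ {P Q : State M → Set} p a →
             (∀ q → P q ⇔ Q q) → Dia M p a P ⇔ Dia M p a Q
  Dia-cong p a P⇔Q =
    (λ (q , t , s) → q , t , proj₁ (P⇔Q q) s) ,
    (λ (q , t , s) → q , t , proj₂ (P⇔Q q) s)

  Box-cong : ∀ {P Q : State M → Set} p a →
             (∀ q → P q ⇔ Q q) → Box M p a P ⇔ Box M p a Q
  Box-cong p a P⇔Q =
    (λ b q t → proj₁ (P⇔Q q) (b q t)) ,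
    (λ b q t → proj₂ (P⇔Q q) (b q t))

module _ {nᵢ nₒ : ℕ} where

  Liocos⇒HML : Liocos nᵢ nₒ → HML nᵢ nₒ
  Liocos⇒HML tt = tt
  Liocos⇒HML ff = ff
  Liocos⇒HML (φ ∧ ψ) = Liocos⇒HML φ ∧ Liocos⇒HML ψ
  Liocos⇒HML (φ ∨ ψ) = Liocos⇒HML φ ∨ Liocos⇒HML ψ
  Liocos⇒HML (⟨⟨ a ⟩⟩ φ) = ([ inp a ] ff) ∨ (⟨ inp a ⟩ Liocos⇒HML φ)
  Liocos⇒HML (⟨out b ⟩ φ) = ⟨ out b ⟩ Liocos⇒HML φ
  Liocos⇒HML (⟨δ⟩ φ) = ⟨ δ ⟩ Liocos⇒HML φ

  Liocos⇒HML-≣ : ∀ φ → φ ≣I Liocos⇒HML φ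
  Liocos⇒HML-≣ tt M p = ⇔-refl
  Liocos⇒HML-≣ ff M p = ⇔-refl
  Liocos⇒HML-≣ (φ ∧ ψ) M p = ×-cong-⇔ (Liocos⇒HML-≣ φ M p) (Liocos⇒HML-≣ ψ M p)
  Liocos⇒HML-≣ (φ ∨ ψ) M p = ⊎-cong-⇔ (Liocos⇒HML-≣ φ M p) (Liocos⇒HML-≣ ψ M p)
  Liocos⇒HML-≣ (⟨⟨ a ⟩⟩ φ) M p =
    ⊎-cong-⇔ ⇔-refl (Dia-cong M p (inp a) (Liocos⇒HML-≣ φ M))
  Liocos⇒HML-≣ (⟨out b ⟩ φ) M p = Dia-cong M p (out b) (Liocos⇒HML-≣ φ M)
  Liocos⇒HML-≣ (⟨δ⟩ φ) M p = Dia-cong M p δ (Liocos⇒HML-≣ φ M)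

  L̃iocos⇒HML : L̃iocos nᵢ nₒ → HML nᵢ nₒ
  L̃iocos⇒HML tt = tt
  L̃iocos⇒HML ff = ff
  L̃iocos⇒HML (φ ∧ ψ) = L̃iocos⇒HML φ ∧ L̃iocos⇒HML ψ
  L̃iocos⇒HML (φ ∨ ψ) = L̃iocos⇒HML φ ∨ L̃iocos⇒HML ψ
  L̃iocos⇒HML ([[ a ]] φ) = (⟨ inp a ⟩ tt) ∧ ([ inp a ] L̃iocos⇒HML φ)
  L̃iocos⇒HML ([out b ] φ) = [ out b ] L̃iocos⇒HML φ
  L̃iocos⇒HML ([δ] φ) = [ δ ] L̃iocos⇒HML φ

  L̃iocos⇒HML-≣ : ∀ φ → φ ≣T L̃iocos⇒HML φ
  L̃iocos⇒HML-≣ tt M p = ⇔-refl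
  L̃iocos⇒HML-≣ ff M p = ⇔-refl
  L̃iocos⇒HML-≣ (φ ∧ ψ) M p = ×-cong-⇔ (L̃iocos⇒HML-≣ φ M p) (L̃iocos⇒HML-≣ ψ M p)
  L̃iocos⇒HML-≣ (φ ∨ ψ) M p = ⊎-cong-⇔ (L̃iocos⇒HML-≣ φ M p) (L̃iocos⇒HML-≣ ψ M p)
  L̃iocos⇒HML-≣ ([[ a ]] φ) M p =
    ×-cong-⇔ ((λ (q , t) → q , t , tt') , (λ (q , t , _) → q , t))
             (Box-cong M p (inp a) (L̃iocos⇒HML-≣ φ M))
  L̃iocos⇒HML-≣ ([out b ] φ) M p = Box-cong M p (out b) (L̃iocos⇒HML-≣ φ M)
  L̃iocos⇒HML-≣ ([δ] φ) M p = Box-cong M p δ (L̃iocos⇒HML-≣ φ M)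

  no-Liocos-equivalent :
    ∀ (M : LTS nᵢ nₒ) {p q} → (∀ φ → satI M p φ → satI M q φ) →
    ∀ ψ → sat M p ψ → ¬ sat M q ψ → ¬ Σ (Liocos nᵢ nₒ) λ φ → φ ≣I ψ
  no-Liocos-equivalent M {p} {q} p⊑q ψ p⊨ψ q⊭ψ (φ , φ≣ψ) =
    q⊭ψ (proj₁ (φ≣ψ M q) (p⊑q φ (proj₂ (φ≣ψ M p) p⊨ψ)))

  no-L̃iocos-equivalent :
    ∀ (M : LTS nᵢ nₒ) {p q} → (∀ φ → satT M p φ → satT M q φ) →
    ∀ ψ → sat M p ψ → ¬ sat M q ψ → ¬ Σ (L̃iocos nᵢ nₒ) λ φ → φ ≣T ψ
  no-L̃iocos-equivalent M {p} {q} p⊑q ψ p⊨ψ q⊭ψ (φ , φ≣ψ) =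
    q⊭ψ (proj₁ (φ≣ψ M q) (p⊑q φ (proj₂ (φ≣ψ M p) p⊨ψ)))

  data Node : Set where
    enabled blocked : Node

  data Step : Node → Label nᵢ nₒ → Node → Set where
    input : ∀ a → Step enabled (inp a) enabled
    quiet : ∀ p → Step p δ p

  Step-image-finite : ∀ p a → Σ (List Node) λ xs → ∀ q → Step p a q ⇔ (q ∈ xs)
  Step-image-finite enabled (inp a) = enabled ∷ [] , λ q →
    (λ { (input .a) → here refl }) , (λ { (here refl) → input a ; (there ()) })
  Step-image-finite blocked (inp a) = [] , λ q → (λ ()) , (λ ())
  Step-image-finite p (out b) = [] , λ q → (λ ()) , (λ ())
  Step-image-finite p δ = p ∷ [] , λ q →
    (λ { (quiet .p) → here refl }) , (λ { (here refl) → quiet p ; (there ()) })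

  inputLoop : LTS nᵢ nₒ
  inputLoop = record
    { State = Node
    ; _—[_]→_ = Step
    ; quiescence = λ p p' →
        (λ { (quiet .p) → refl , λ b q () }) , (λ { (refl , _) → quiet p })
    ; image-finite = Step-image-finite
    }

  satI-enabled⇒blocked : ∀ φ → satI inputLoop enabled φ → satI inputLoop blocked φ
  satI-enabled⇒blocked tt s = s
  satI-enabled⇒blocked ff ()
  satI-enabled⇒blocked (φ ∧ ψ) (s , t) = satI-enabled⇒blocked φ s , satI-enabled⇒blocked ψ t
  satI-enabled⇒blocked (φ ∨ ψ) (inj₁ s) = inj₁ (satI-enabled⇒blocked φ s)
  satI-enabled⇒blocked (φ ∨ ψ) (inj₂ t) = inj₂ (satI-enabled⇒blocked ψ t)
  satI-enabled⇒blocked (⟨⟨ a ⟩⟩ φ) _ = inj₁ λ q ()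
  satI-enabled⇒blocked (⟨out b ⟩ φ) (_ , () , _)
  satI-enabled⇒blocked (⟨δ⟩ φ) (.enabled , quiet .enabled , s) =
    blocked , quiet blocked , satI-enabled⇒blocked φ s

  satT-blocked⇒enabled : ∀ φ → satT inputLoop blocked φ → satT inputLoop enabled φ
  satT-blocked⇒enabled tt s = s
  satT-blocked⇒enabled ff ()
  satT-blocked⇒enabled (φ ∧ ψ) (s , t) = satT-blocked⇒enabled φ s , satT-blocked⇒enabled ψ t
  satT-blocked⇒enabled (φ ∨ ψ) (inj₁ s) = inj₁ (satT-blocked⇒enabled φ s)
  satT-blocked⇒enabled (φ ∨ ψ) (inj₂ t) = inj₂ (satT-blocked⇒enabled ψ t)
  satT-blocked⇒enabled ([[ a ]] φ) ((_ , ()) , _)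
  satT-blocked⇒enabled ([out b ] φ) _ q ()
  satT-blocked⇒enabled ([δ] φ) s .enabled (quiet .enabled) =
    satT-blocked⇒enabled φ (s blocked (quiet blocked))

  ⟨input⟩tt-inexpressibleI : (a : Fin nᵢ) → ¬ Σ (Liocos nᵢ nₒ) λ φ → φ ≣I (⟨ inp a ⟩ tt)
  ⟨input⟩tt-inexpressibleI a =
    no-Liocos-equivalent inputLoop satI-enabled⇒blocked (⟨ inp a ⟩ tt)
      (enabled , input a , tt') λ { (_ , () , _) }

  [input]ff-inexpressibleT : (a : Fin nᵢ) → ¬ Σ (L̃iocos nᵢ nₒ) λ φ → φ ≣T ([ inp a ] ff)
  [input]ff-inexpressibleT a =
    no-L̃iocos-equivalent inputLoop satT-blocked⇒enabled ([ inp a ] ff)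
      (λ q ()) λ s → s enabled (input a)

proposition2 : (nᵢ nₒ : ℕ) →
    ((∀ (φ : Liocos (suc nᵢ) nₒ) → Σ (HML (suc nᵢ) nₒ) λ ψ → φ ≣I ψ)
      × (Σ (HML (suc nᵢ) nₒ) λ ψ → ¬ (Σ (Liocos (suc nᵢ) nₒ) λ φ → φ ≣I ψ)))
    × ((∀ (φ : L̃iocos (suc nᵢ) nₒ) → Σ (HML (suc nᵢ) nₒ) λ ψ → φ ≣T ψ)
      × (Σ (HML (suc nᵢ) nₒ) λ ψ → ¬ (Σ (L̃iocos (suc nᵢ) nₒ) λ φ → φ ≣T ψ)))
proposition2 nᵢ nₒ =
  ( (λ φ → Liocos⇒HML φ , Liocos⇒HML-≣ φ)
  , (⟨ inp zero ⟩ tt , ⟨input⟩tt-inexpressibleI zero) )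
  , ( (λ φ → L̃iocos⇒HML φ , L̃iocos⇒HML-≣ φ)
    , ([ inp zero ] ff , [input]ff-inexpressibleT zero) )
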